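{- Let $G = Z_{22}\times Z_{46}$ with multiplication $[x,y][u,v] = [x+u \bmod 22,\; y\cdot 25^{u} + v \bmod 46]$ (a group of order $1012$). Let $S=\{g,g^{ -1} : g\in\{[1,7],[14,33],[18,19],[4,44]\}\}$. Then $S$ consists of exactly $8$ non-identity elements and the Cayley graph $\mathrm{Cay}(G,S)$ is a connected $8$-regular graph of diameter $4$ on $1012$ vertices.
   Context: For a finite group $G$ and an inverse-closed subset $S\subseteq G$ not containing the identity, the Cayley graph $\mathrm{Cay}(G,S)$ is the undirected graph with vertex set $G$ in which $x$ and $y$ are adjacent iff $y=xs$ for some $s\in S$; it is $|S|$-regular. The diameter of a connected graph is the maximum over all pairs of vertices of the length of a shortest path between them. For integers $m,n$ and a unit $a$ of $Z_n$ whose multiplicative order divides $m$, the group $m\times_a n$ is the set $Z_m\times Z_n$ with multiplication $[x,y][u,v]=[x+u \bmod m,\; y a^u+v \bmod n]$. -}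

module Defs where

open import Data.Nat using (ℕ; zero; suc; _+_; _*_; _∸_; _^_; _≤_)
open import Data.Nat.DivMod using (_mod_; _%_)
open import Data.Fin using (Fin; toℕ)
open import Data.Product using (_×_; _,_; ∃; Σ)
open import Data.List using (List; []; _∷_; _++_; map; length)
open import Data.List.Membership.Propositional using (_∈_)
open import Data.List.Relation.Unary.Unique.Propositional using (Unique)
open import Relation.Binary.PropositionalEquality using (_≡_)
open import Relation.Nullary using (¬_)
open import Function.Bundles using (_⇔_)

G : Set
G = Fin 22 × Fin 46

_·_ : G → G → G
(x , y) · (u , v) = ((toℕ x + toℕ u) mod 22) , ((toℕ y * 25 ^ toℕ u + toℕ v) mod 46)

e : G
e = (0 mod 22) , (0 mod 46)

inv : G → G
inv (x , y) = u , ((46 ∸ ((toℕ y * 25 ^ toℕ u) % 46)) mod 46)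
  where u = (22 ∸ toℕ x) mod 22

mk : ℕ → ℕ → G
mk a b = (a mod 22) , (b mod 46)

gens : List G
gens = mk 1 7 ∷ mk 14 33 ∷ mk 18 19 ∷ mk 4 44 ∷ []

S : List G
S = gens ++ map inv gens

Adj : G → G → Set
Adj x y = ∃ λ s → s ∈ S × y ≡ x · s

data Walk : G → G → ℕ → Set where
  here : ∀ {x} → Walk x x 0
  step : ∀ {x y z n} → Adj x y → Walk y z n → Walk x z (suc n)

DistLE : G → G → ℕ → Set
DistLE x y k = ∃ λ n → n ≤ k × Walk x y n

Connected : Set
Connected = ∀ x y → ∃ λ n → Walk x y n

Regular : ℕ → Set
Regular k = ∀ x → Σ (List G) λ L → length L ≡ k × Unique L × (∀ y → (y ∈ L ⇔ Adj x y))

Diameter : ℕ → Set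
Diameter d = (∀ x y → DistLE x y d) × ∃ λ x → ∃ λ y → ∀ n → Walk x y n → d ≤ n

{-# OPTIONS --safe #-}
-- G is the semidirect product Z₂₂ ⋉ Z₄₆ in which 1 ∈ Z₂₂ acts by multiplication
-- by 25; since 25²² ≡ 1 (mod 46) the exponent of 25 may be reduced mod 22, which
-- makes the multiplication associative.  Walks from x
-- in Cay(G,S) are words in S read from x, so dist(x,y) ≤ 4 follows from a table of
-- words of length ≤ 4 spelling each of the 1012 elements (applied to x⁻¹y), and
-- dist(e,[4,36]) ≥ 4 from an exhaustive search of the 8³ walks of length ≤ 3.
-- Left cancellation makes the 8 neighbours x·s of x distinct.
module Submission where

open import Defs
open import Level using (0ℓ)
open import Data.Nat using (ℕ; zero; suc; _+_; _*_; _^_; _%_; _≤_; _≤?_; NonZero; >-nonZero⁻¹)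
open import Data.Nat.Properties
  using (+-assoc; +-identityʳ; *-identityʳ; *-comm; ^-distribˡ-+-*; ^-*-assoc; ^-zeroˡ; m≤m+n)
open import Data.Nat.DivMod
  using (_mod_; _/_; %-distribˡ-+; %-distribˡ-*; m%n%n≡m%n; m≡m%n+[m/n]*n; m<n⇒m%n≡m)
open import Data.Nat.Tactic.RingSolver using (solve-∀)
open import Data.Fin using (Fin; toℕ)
open import Data.Fin.Properties using (toℕ-fromℕ<; toℕ<n; toℕ-injective; *↔×) renaming (_≟_ to _≟ᶠ_; all? to allᶠ?)
open import Data.Product using (_×_; _,_; proj₁; proj₂)
open import Data.Product.Properties using (≡-dec)
open import Data.List using (List; []; _∷_; length; map)
open import Data.List.Membership.Propositional using (_∈_; find; lose)
open import Data.List.Membership.Propositional.Properties using (∈-map⁺; ∈-map⁻)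
open import Data.List.Relation.Unary.Any using (Any; here; there; any?)
open import Data.List.Relation.Unary.All using (All; all?)
open import Data.List.Relation.Unary.AllPairs using (allPairs?)
open import Data.List.Relation.Unary.Unique.Propositional using (Unique)
import Data.List.Relation.Unary.Unique.Propositional.Properties as Unique
open import Data.Vec using (Vec; []; _∷_; lookup)
open import Data.Empty using (⊥-elim)
open import Data.Unit using (tt)
open import Algebra.Bundles using (Group)
import Algebra.Properties.Group as GroupProperties
open import Relation.Nullary using (Dec; ¬?)
open import Relation.Nullary.Decidable using (map′; _×-dec_; toWitness; toWitnessFalse)
open import Relation.Binary.Bundles using (Setoid)
import Relation.Binary.Construct.On as On
import Relation.Binary.Reasoning.Setoid as SetoidReasoning
open import Relation.Binary.PropositionalEquality
  using (_≡_; _≢_; refl; sym; trans; cong; cong₂; subst; isEquivalence; module ≡-Reasoning)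
  renaming (setoid to ≡-setoid)
open import Algebra.Structures {A = G} _≡_ using (IsGroup)
open import Function.Bundles using (_↔_; mk⇔)
open import Function.Properties.Inverse using (↔-sym)
open import Function.Base using (_∘_)

ℕ-mod : (d : ℕ) → .{{NonZero d}} → Setoid 0ℓ 0ℓ
ℕ-mod d = On.setoid (≡-setoid ℕ) (_% d)

module _ (d : ℕ) .{{_ : NonZero d}} where

  toℕ-mod : ∀ a → toℕ (a mod d) ≡ a % d
  toℕ-mod a = toℕ-fromℕ< _

  toℕ-mod% : ∀ a → toℕ (a mod d) % d ≡ a % d
  toℕ-mod% a = trans (cong (_% d) (toℕ-mod a)) (m%n%n≡m%n a d)

  toℕ-0-mod : toℕ (0 mod d) ≡ 0
  toℕ-0-mod = trans (toℕ-mod 0) (m<n⇒m%n≡m (>-nonZero⁻¹ d))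

  mod-cong : ∀ {a b} → a % d ≡ b % d → a mod d ≡ b mod d
  mod-cong {a} {b} a≡b = toℕ-injective (begin
    toℕ (a mod d) ≡⟨ toℕ-mod a ⟩
    a % d         ≡⟨ a≡b ⟩
    b % d         ≡⟨ toℕ-mod b ⟨
    toℕ (b mod d) ∎)
    where open ≡-Reasoning

  mod-toℕ : ∀ {a} (i : Fin d) → a % d ≡ toℕ i % d → a mod d ≡ i
  mod-toℕ {a} i a≡i = toℕ-injective (begin
    toℕ (a mod d) ≡⟨ toℕ-mod a ⟩
    a % d         ≡⟨ a≡i ⟩
    toℕ i % d     ≡⟨ m<n⇒m%n≡m (toℕ<n i) ⟩
    toℕ i         ∎)
    where open ≡-Reasoning

  +-cong-mod : ∀ {a b c e} → a % d ≡ b % d → c % d ≡ e % d → (a + c) % d ≡ (b + e) % d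
  +-cong-mod {a} {b} {c} {e} a≡b c≡e = begin
    (a + c) % d           ≡⟨ %-distribˡ-+ a c d ⟩
    (a % d + c % d) % d   ≡⟨ cong₂ (λ u v → (u + v) % d) a≡b c≡e ⟩
    (b % d + e % d) % d   ≡⟨ %-distribˡ-+ b e d ⟨
    (b + e) % d           ∎
    where open ≡-Reasoning

  *-cong-mod : ∀ {a b c e} → a % d ≡ b % d → c % d ≡ e % d → (a * c) % d ≡ (b * e) % d
  *-cong-mod {a} {b} {c} {e} a≡b c≡e = begin
    (a * c) % d           ≡⟨ %-distribˡ-* a c d ⟩
    (a % d * (c % d)) % d ≡⟨ cong₂ (λ u v → (u * v) % d) a≡b c≡e ⟩
    (b % d * (e % d)) % d ≡⟨ %-distribˡ-* b e d ⟨
    (b * e) % d           ∎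
    where open ≡-Reasoning

  ^-congˡ-mod : ∀ {a b} → a % d ≡ b % d → ∀ k → a ^ k % d ≡ b ^ k % d
  ^-congˡ-mod a≡b zero    = refl
  ^-congˡ-mod a≡b (suc k) = *-cong-mod a≡b (^-congˡ-mod a≡b k)

  ^-exponent-mod : ∀ {a} m .{{_ : NonZero m}} → a ^ m % d ≡ 1 % d →
                   ∀ k → a ^ (k % m) % d ≡ a ^ k % d
  ^-exponent-mod {a} m aᵐ≡1 k = begin
    a ^ r                ≡⟨ *-identityʳ (a ^ r) ⟨
    a ^ r * 1            ≈⟨ *-cong-mod {a ^ r} refl aᵐᑫ≡1 ⟨
    a ^ r * a ^ (q * m)  ≡⟨ ^-distribˡ-+-* a r (q * m) ⟨
    a ^ (r + q * m)      ≡⟨ cong (a ^_) (m≡m%n+[m/n]*n k m) ⟨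
    a ^ k                ∎
    where
    open SetoidReasoning (ℕ-mod d)
    r = k % m
    q = k / m
    aᵐᑫ≡1 : a ^ (q * m) % d ≡ 1 % d
    aᵐᑫ≡1 = begin
      a ^ (q * m)  ≡⟨ cong (a ^_) (*-comm q m) ⟩
      a ^ (m * q)  ≡⟨ ^-*-assoc a m q ⟨
      (a ^ m) ^ q  ≈⟨ ^-congˡ-mod aᵐ≡1 q ⟩
      1 ^ q        ≡⟨ ^-zeroˡ q ⟩
      1            ∎

module SemidirectProduct (m n a : ℕ) .{{_ : NonZero m}} .{{_ : NonZero n}} where

  open import Algebra.Definitions {A = Fin m × Fin n} _≡_ using (Associative; LeftIdentity; RightIdentity)

  infixl 7 _∙_
  _∙_ : Fin m × Fin n → Fin m × Fin n → Fin m × Fin n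
  (x , y) ∙ (u , v) = ((toℕ x + toℕ u) mod m) , ((toℕ y * a ^ toℕ u + toℕ v) mod n)

  ε : Fin m × Fin n
  ε = (0 mod m) , (0 mod n)

  ∙-identityˡ : LeftIdentity ε _∙_
  ∙-identityˡ (u , v) = cong₂ _,_
    (mod-toℕ m u (+-cong-mod m (toℕ-mod% m 0) refl))
    (mod-toℕ n v (+-cong-mod n (*-cong-mod n (toℕ-mod% n 0) refl) refl))

  ∙-identityʳ : RightIdentity ε _∙_
  ∙-identityʳ (x , y) = cong₂ _,_ (mod-toℕ m x first) (mod-toℕ n y second)
    where
    X = toℕ x
    Y = toℕ y
    first : (X + toℕ (0 mod m)) % m ≡ X % m
    first = cong (_% m) (trans (cong (X +_) (toℕ-0-mod m)) (+-identityʳ X))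
    second : (Y * a ^ toℕ (0 mod m) + toℕ (0 mod n)) % n ≡ Y % n
    second = cong (_% n) (begin
      Y * a ^ toℕ (0 mod m) + toℕ (0 mod n) ≡⟨ cong₂ (λ i j → Y * a ^ i + j) (toℕ-0-mod m) (toℕ-0-mod n) ⟩
      Y * 1 + 0                             ≡⟨ +-identityʳ (Y * 1) ⟩
      Y * 1                                 ≡⟨ *-identityʳ Y ⟩
      Y                                     ∎)
      where open ≡-Reasoning

  ∙-assoc : a ^ m % n ≡ 1 % n → Associative _∙_
  ∙-assoc aᵐ≡1 (x , y) (u , v) (p , q) = cong₂ _,_ (mod-cong m first) (mod-cong n second)
    where
    X = toℕ x ; Y = toℕ y ; U = toℕ u ; V = toℕ v ; P = toℕ p ; Q = toℕ q

    first : (toℕ ((X + U) mod m) + P) % m ≡ (X + toℕ ((U + P) mod m)) % m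
    first = begin
      toℕ ((X + U) mod m) + P  ≈⟨ +-cong-mod m (toℕ-mod% m (X + U)) refl ⟩
      X + U + P                ≡⟨ +-assoc X U P ⟩
      X + (U + P)              ≈⟨ +-cong-mod m {X} refl (toℕ-mod% m (U + P)) ⟨
      X + toℕ ((U + P) mod m)  ∎
      where open SetoidReasoning (ℕ-mod m)

    expand : ∀ y s v t q → (y * s + v) * t + q ≡ y * (s * t) + (v * t + q)
    expand = solve-∀

    second : (toℕ ((Y * a ^ U + V) mod n) * a ^ P + Q) % n
           ≡ (Y * a ^ toℕ ((U + P) mod m) + toℕ ((V * a ^ P + Q) mod n)) % n
    second = begin
      toℕ ((Y * a ^ U + V) mod n) * a ^ P + Q
        ≈⟨ +-cong-mod n (*-cong-mod n (toℕ-mod% n (Y * a ^ U + V)) refl) refl ⟩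
      (Y * a ^ U + V) * a ^ P + Q
        ≡⟨ expand Y (a ^ U) V (a ^ P) Q ⟩
      Y * (a ^ U * a ^ P) + (V * a ^ P + Q)
        ≡⟨ cong (λ k → Y * k + (V * a ^ P + Q)) (^-distribˡ-+-* a U P) ⟨
      Y * a ^ (U + P) + (V * a ^ P + Q)
        ≈⟨ +-cong-mod n (*-cong-mod n {Y} refl (^-exponent-mod n m aᵐ≡1 (U + P))) (toℕ-mod% n _) ⟨
      Y * a ^ ((U + P) % m) + toℕ ((V * a ^ P + Q) mod n)
        ≡⟨ cong (λ k → Y * a ^ k + toℕ ((V * a ^ P + Q) mod n)) (toℕ-mod m (U + P)) ⟨
      Y * a ^ toℕ ((U + P) mod m) + toℕ ((V * a ^ P + Q) mod n)
        ∎
      where open SetoidReasoning (ℕ-mod n)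

infix 4 _≟_
_≟_ : (g h : G) → Dec (g ≡ h)
_≟_ = ≡-dec _≟ᶠ_ _≟ᶠ_

∀-Fin×? : ∀ {m n} {P : Fin m × Fin n → Set} → (∀ g → Dec (P g)) → Dec (∀ g → P g)
∀-Fin×? P? = map′ (λ ∀xy (x , y) → ∀xy x y) (λ ∀g x y → ∀g (x , y))
               (allᶠ? λ x → allᶠ? λ y → P? (x , y))

·-inverse : ∀ g → (g · inv g ≡ e) × (inv g · g ≡ e)
·-inverse = toWitness {a? = ∀-Fin×? λ g → (g · inv g ≟ e) ×-dec (inv g · g ≟ e)} tt

isGroup : IsGroup _·_ e inv
isGroup = record
  { isMonoid = record
    { isSemigroup = record
      { isMagma = record { isEquivalence = isEquivalence ; ∙-cong = cong₂ _·_ }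
      ; assoc = ∙-assoc refl
      }
    ; identity = ∙-identityˡ , ∙-identityʳ
    }
  ; inverse = (λ g → proj₂ (·-inverse g)) , (λ g → proj₁ (·-inverse g))
  ; ⁻¹-cong = cong inv
  }
  where open SemidirectProduct 22 46 25

group : Group 0ℓ 0ℓ
group = record { isGroup = isGroup }

open Group group using (assoc; identityʳ)
open GroupProperties group using (∙-cancelˡ; \\-leftDividesˡ)

S-unique : Unique S
S-unique = toWitness {a? = allPairs? (λ g h → ¬? (g ≟ h)) S} tt

S-nonidentity : All (_≢ e) S
S-nonidentity = toWitness {a? = all? (λ s → ¬? (s ≟ e)) S} tt

regular : Regular 8
regular x = map (x ·_) S , refl , Unique.map⁺ (∙-cancelˡ x _ _) S-unique ,
  λ y → mk⇔ (∈-map⁻ (x ·_)) (λ { (s , s∈S , refl) → ∈-map⁺ (x ·_) s∈S })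

data Letter : Set where
  a b c d A B C D : Letter

letter : Letter → G
letter a = mk 1 7
letter b = mk 14 33
letter c = mk 18 19
letter d = mk 4 44
letter A = inv (mk 1 7)
letter B = inv (mk 14 33)
letter C = inv (mk 18 19)
letter D = inv (mk 4 44)

letter-∈S : ∀ l → letter l ∈ S
letter-∈S a = here refl
letter-∈S b = there (here refl)
letter-∈S c = there (there (here refl))
letter-∈S d = there (there (there (here refl)))
letter-∈S A = there (there (there (there (here refl))))
letter-∈S B = there (there (there (there (there (here refl)))))
letter-∈S C = there (there (there (there (there (there (here refl))))))
letter-∈S D = there (there (there (there (there (there (there (here refl)))))))

Word : Set
Word = List Letter

eval : Word → G
eval []      = e
eval (l ∷ w) = letter l · eval w

walk-eval : ∀ x w → Walk x (x · eval w) (length w)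
walk-eval x []      = subst (λ y → Walk x y 0) (sym (identityʳ x)) here
walk-eval x (l ∷ w) = step (letter l , letter-∈S l , refl)
  (subst (λ y → Walk (x · letter l) y (length w)) (assoc x (letter l) (eval w)) (walk-eval (x · letter l) w))

walk-to : ∀ x y w → eval w ≡ inv x · y → Walk x y (length w)
walk-to x y w w≡x⁻¹y = subst (λ z → Walk x z (length w))
  (trans (cong (x ·_) w≡x⁻¹y) (\\-leftDividesˡ x y)) (walk-eval x w)

walk? : ∀ x y n → Dec (Walk x y n)
walk? x y zero    = map′ (λ { refl → here }) (λ { here → refl }) (x ≟ y)
walk? x y (suc n) = map′ fromAny toAny (any? (λ s → walk? (x · s) y n) S)
  where
  fromAny : Any (λ s → Walk (x · s) y n) S → Walk x y (suc n)
  fromAny someWalk = let s , s∈S , walk = find someWalk in step (s , s∈S , refl) walk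
  toAny : Walk x y (suc n) → Any (λ s → Walk (x · s) y n) S
  toAny (step (s , s∈S , refl) walk) = lose s∈S walk

-- Found by breadth-first search from e.
table : Vec (Vec Word 46) 22
table =
  ( [] ∷ (a ∷ D ∷ A ∷ C ∷ []) ∷ (B ∷ D ∷ c ∷ []) ∷ (c ∷ d ∷ []) ∷ (a ∷ D ∷ A ∷ d ∷ []) ∷
    (A ∷ d ∷ a ∷ c ∷ []) ∷ (D ∷ c ∷ B ∷ []) ∷ (C ∷ D ∷ []) ∷ (B ∷ a ∷ b ∷ A ∷ []) ∷
    (c ∷ c ∷ B ∷ []) ∷ (B ∷ c ∷ D ∷ []) ∷ (b ∷ D ∷ B ∷ C ∷ []) ∷ (A ∷ d ∷ a ∷ D ∷ []) ∷
    (a ∷ c ∷ d ∷ A ∷ []) ∷ (d ∷ b ∷ C ∷ []) ∷ (a ∷ C ∷ D ∷ A ∷ []) ∷ (b ∷ d ∷ C ∷ []) ∷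
    (d ∷ b ∷ d ∷ []) ∷ (A ∷ c ∷ a ∷ C ∷ []) ∷ (b ∷ d ∷ d ∷ []) ∷ (b ∷ c ∷ B ∷ C ∷ []) ∷
    (C ∷ b ∷ C ∷ []) ∷ (D ∷ B ∷ c ∷ []) ∷ (b ∷ c ∷ B ∷ d ∷ []) ∷ (C ∷ b ∷ d ∷ []) ∷
    (c ∷ B ∷ c ∷ []) ∷ (c ∷ b ∷ C ∷ B ∷ []) ∷ (D ∷ D ∷ B ∷ []) ∷ (c ∷ c ∷ d ∷ d ∷ []) ∷
    (D ∷ B ∷ D ∷ []) ∷ (c ∷ D ∷ B ∷ []) ∷ (a ∷ d ∷ c ∷ A ∷ []) ∷ (c ∷ B ∷ D ∷ []) ∷
    (a ∷ d ∷ A ∷ c ∷ []) ∷ (d ∷ A ∷ D ∷ a ∷ []) ∷ (c ∷ b ∷ d ∷ B ∷ []) ∷ (d ∷ C ∷ b ∷ []) ∷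
    (b ∷ C ∷ C ∷ []) ∷ (a ∷ B ∷ A ∷ b ∷ []) ∷ (d ∷ c ∷ []) ∷ (b ∷ C ∷ d ∷ []) ∷
    (b ∷ d ∷ B ∷ c ∷ []) ∷ (c ∷ d ∷ d ∷ c ∷ []) ∷ (D ∷ C ∷ []) ∷ (C ∷ d ∷ b ∷ []) ∷
    (c ∷ a ∷ d ∷ A ∷ []) ∷ []
  ) ∷
  ( (a ∷ d ∷ c ∷ []) ∷ (a ∷ b ∷ C ∷ d ∷ []) ∷ (c ∷ c ∷ B ∷ a ∷ []) ∷ (C ∷ a ∷ c ∷ []) ∷
    (a ∷ D ∷ C ∷ []) ∷ (b ∷ a ∷ B ∷ []) ∷ (b ∷ A ∷ b ∷ c ∷ []) ∷ (a ∷ []) ∷ (D ∷ B ∷ a ∷ D ∷ []) ∷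
    (a ∷ B ∷ D ∷ c ∷ []) ∷ (a ∷ c ∷ d ∷ []) ∷ (b ∷ d ∷ a ∷ C ∷ []) ∷ (d ∷ a ∷ c ∷ []) ∷
    (a ∷ D ∷ c ∷ B ∷ []) ∷ (a ∷ C ∷ D ∷ []) ∷ (A ∷ A ∷ A ∷ d ∷ []) ∷ (d ∷ c ∷ a ∷ []) ∷
    (a ∷ B ∷ c ∷ D ∷ []) ∷ (b ∷ b ∷ A ∷ c ∷ []) ∷ (d ∷ a ∷ D ∷ []) ∷ (B ∷ B ∷ B ∷ A ∷ []) ∷
    (a ∷ d ∷ b ∷ C ∷ []) ∷ (b ∷ d ∷ d ∷ a ∷ []) ∷ (B ∷ a ∷ b ∷ []) ∷ (D ∷ C ∷ a ∷ []) ∷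
    (c ∷ a ∷ C ∷ []) ∷ (a ∷ b ∷ d ∷ d ∷ []) ∷ (B ∷ c ∷ D ∷ a ∷ []) ∷ (c ∷ a ∷ d ∷ []) ∷
    (a ∷ D ∷ B ∷ c ∷ []) ∷ (b ∷ C ∷ a ∷ C ∷ []) ∷ (a ∷ C ∷ b ∷ d ∷ []) ∷ (a ∷ c ∷ B ∷ c ∷ []) ∷
    (b ∷ C ∷ a ∷ d ∷ []) ∷ (a ∷ D ∷ D ∷ B ∷ []) ∷ (d ∷ b ∷ C ∷ a ∷ []) ∷ (c ∷ d ∷ a ∷ []) ∷
    (a ∷ c ∷ D ∷ B ∷ []) ∷ (A ∷ b ∷ c ∷ b ∷ []) ∷ (a ∷ c ∷ B ∷ D ∷ []) ∷ (c ∷ b ∷ b ∷ A ∷ []) ∷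
    (b ∷ C ∷ d ∷ a ∷ []) ∷ (D ∷ a ∷ C ∷ []) ∷ (a ∷ d ∷ C ∷ b ∷ []) ∷ (C ∷ D ∷ a ∷ []) ∷
    (D ∷ a ∷ d ∷ []) ∷ []
  ) ∷
  ( (b ∷ b ∷ D ∷ []) ∷ (B ∷ B ∷ B ∷ []) ∷ (A ∷ d ∷ A ∷ []) ∷ (A ∷ A ∷ C ∷ []) ∷
    (c ∷ b ∷ D ∷ D ∷ []) ∷ (C ∷ A ∷ A ∷ []) ∷ (A ∷ A ∷ d ∷ []) ∷ (a ∷ d ∷ c ∷ a ∷ []) ∷
    (D ∷ b ∷ D ∷ c ∷ []) ∷ (c ∷ a ∷ a ∷ d ∷ []) ∷ (a ∷ d ∷ a ∷ D ∷ []) ∷ (c ∷ D ∷ c ∷ b ∷ []) ∷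
    (A ∷ A ∷ c ∷ B ∷ []) ∷ (b ∷ d ∷ b ∷ b ∷ []) ∷ (a ∷ B ∷ a ∷ b ∷ []) ∷ (a ∷ D ∷ C ∷ a ∷ []) ∷
    (b ∷ D ∷ b ∷ []) ∷ (b ∷ b ∷ b ∷ d ∷ []) ∷ (b ∷ D ∷ D ∷ c ∷ []) ∷ (a ∷ c ∷ a ∷ d ∷ []) ∷
    (B ∷ A ∷ A ∷ c ∷ []) ∷ (c ∷ D ∷ b ∷ c ∷ []) ∷ (d ∷ a ∷ D ∷ a ∷ []) ∷ (B ∷ d ∷ B ∷ C ∷ []) ∷
    (D ∷ c ∷ b ∷ D ∷ []) ∷ (b ∷ D ∷ D ∷ D ∷ []) ∷ (b ∷ D ∷ c ∷ D ∷ []) ∷ (a ∷ c ∷ d ∷ a ∷ []) ∷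
    (b ∷ C ∷ b ∷ b ∷ []) ∷ (b ∷ c ∷ b ∷ []) ∷ (d ∷ B ∷ d ∷ B ∷ []) ∷ (b ∷ c ∷ D ∷ c ∷ []) ∷
    (b ∷ c ∷ c ∷ c ∷ []) ∷ (a ∷ D ∷ a ∷ C ∷ []) ∷ (c ∷ a ∷ C ∷ a ∷ []) ∷ (A ∷ C ∷ A ∷ []) ∷
    (a ∷ D ∷ a ∷ d ∷ []) ∷ (a ∷ a ∷ d ∷ c ∷ []) ∷ (b ∷ a ∷ a ∷ B ∷ []) ∷ (b ∷ b ∷ c ∷ []) ∷
    (a ∷ C ∷ a ∷ c ∷ []) ∷ (c ∷ b ∷ b ∷ []) ∷ (a ∷ b ∷ a ∷ B ∷ []) ∷ (c ∷ b ∷ D ∷ c ∷ []) ∷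
    (a ∷ a ∷ []) ∷ (A ∷ B ∷ A ∷ D ∷ []) ∷ []
  ) ∷
  ( (a ∷ c ∷ b ∷ b ∷ []) ∷ (b ∷ d ∷ A ∷ B ∷ []) ∷ (c ∷ A ∷ C ∷ C ∷ []) ∷ (a ∷ a ∷ a ∷ []) ∷
    (B ∷ A ∷ D ∷ []) ∷ (a ∷ b ∷ b ∷ D ∷ []) ∷ (a ∷ B ∷ B ∷ B ∷ []) ∷ (d ∷ A ∷ []) ∷ (A ∷ C ∷ []) ∷
    (b ∷ D ∷ a ∷ b ∷ []) ∷ (B ∷ D ∷ A ∷ []) ∷ (A ∷ d ∷ []) ∷ (b ∷ b ∷ a ∷ c ∷ []) ∷
    (b ∷ a ∷ D ∷ b ∷ []) ∷ (d ∷ A ∷ C ∷ D ∷ []) ∷ (A ∷ C ∷ C ∷ D ∷ []) ∷ (b ∷ b ∷ c ∷ a ∷ []) ∷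
    (A ∷ c ∷ B ∷ []) ∷ (A ∷ d ∷ C ∷ D ∷ []) ∷ (b ∷ b ∷ a ∷ D ∷ []) ∷ (c ∷ b ∷ b ∷ a ∷ []) ∷
    (a ∷ b ∷ D ∷ b ∷ []) ∷ (d ∷ C ∷ D ∷ A ∷ []) ∷ (b ∷ d ∷ B ∷ A ∷ []) ∷ (b ∷ A ∷ B ∷ C ∷ []) ∷
    (C ∷ d ∷ c ∷ A ∷ []) ∷ (b ∷ a ∷ c ∷ b ∷ []) ∷ (b ∷ A ∷ B ∷ d ∷ []) ∷ (B ∷ C ∷ b ∷ A ∷ []) ∷
    (A ∷ D ∷ C ∷ C ∷ []) ∷ (b ∷ C ∷ B ∷ A ∷ []) ∷ (d ∷ b ∷ A ∷ B ∷ []) ∷ (D ∷ B ∷ A ∷ []) ∷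
    (c ∷ B ∷ A ∷ []) ∷ (a ∷ b ∷ c ∷ b ∷ []) ∷ (D ∷ b ∷ a ∷ b ∷ []) ∷ (b ∷ a ∷ b ∷ c ∷ []) ∷
    (C ∷ A ∷ D ∷ C ∷ []) ∷ (A ∷ D ∷ B ∷ []) ∷ (b ∷ D ∷ b ∷ a ∷ []) ∷ (C ∷ A ∷ []) ∷
    (B ∷ c ∷ A ∷ []) ∷ (b ∷ c ∷ b ∷ a ∷ []) ∷ (B ∷ A ∷ c ∷ []) ∷ (a ∷ b ∷ b ∷ c ∷ []) ∷
    (d ∷ B ∷ A ∷ b ∷ []) ∷ []
  ) ∷
  ( (b ∷ b ∷ A ∷ A ∷ []) ∷ (d ∷ c ∷ d ∷ []) ∷ (C ∷ C ∷ D ∷ []) ∷ (b ∷ d ∷ d ∷ d ∷ []) ∷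
    (c ∷ B ∷ []) ∷ (d ∷ C ∷ D ∷ []) ∷ (A ∷ d ∷ a ∷ []) ∷ (c ∷ B ∷ c ∷ d ∷ []) ∷
    (d ∷ B ∷ c ∷ D ∷ []) ∷ (C ∷ d ∷ b ∷ C ∷ []) ∷ (A ∷ b ∷ b ∷ A ∷ []) ∷ (c ∷ B ∷ C ∷ D ∷ []) ∷
    (b ∷ C ∷ C ∷ C ∷ []) ∷ (c ∷ c ∷ d ∷ B ∷ []) ∷ (d ∷ b ∷ d ∷ C ∷ []) ∷ (b ∷ C ∷ C ∷ d ∷ []) ∷
    (D ∷ C ∷ C ∷ []) ∷ (B ∷ C ∷ b ∷ []) ∷ (B ∷ d ∷ b ∷ []) ∷ (D ∷ C ∷ d ∷ []) ∷ (B ∷ c ∷ []) ∷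
    (b ∷ C ∷ B ∷ []) ∷ (d ∷ C ∷ b ∷ d ∷ []) ∷ (c ∷ d ∷ d ∷ []) ∷ (b ∷ d ∷ C ∷ d ∷ []) ∷
    (D ∷ B ∷ []) ∷ (c ∷ a ∷ B ∷ A ∷ []) ∷ (B ∷ D ∷ []) ∷ (a ∷ B ∷ c ∷ A ∷ []) ∷
    (c ∷ d ∷ c ∷ B ∷ []) ∷ (b ∷ d ∷ B ∷ []) ∷ (C ∷ d ∷ C ∷ b ∷ []) ∷ (C ∷ b ∷ C ∷ C ∷ []) ∷
    (B ∷ a ∷ D ∷ A ∷ []) ∷ (C ∷ d ∷ c ∷ []) ∷ (d ∷ b ∷ C ∷ C ∷ []) ∷ (a ∷ a ∷ a ∷ a ∷ []) ∷
    (d ∷ d ∷ c ∷ []) ∷ (C ∷ D ∷ C ∷ []) ∷ (C ∷ C ∷ d ∷ b ∷ []) ∷ (a ∷ d ∷ A ∷ []) ∷ (C ∷ []) ∷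
    (b ∷ A ∷ b ∷ A ∷ []) ∷ (a ∷ B ∷ D ∷ A ∷ []) ∷ (d ∷ []) ∷ (c ∷ d ∷ B ∷ c ∷ []) ∷ []
  ) ∷
  ( (b ∷ D ∷ D ∷ A ∷ []) ∷ (a ∷ c ∷ B ∷ []) ∷ (a ∷ d ∷ C ∷ D ∷ []) ∷ (d ∷ a ∷ []) ∷
    (B ∷ a ∷ D ∷ []) ∷ (D ∷ a ∷ d ∷ d ∷ []) ∷ (b ∷ a ∷ B ∷ C ∷ []) ∷ (b ∷ b ∷ A ∷ []) ∷
    (b ∷ A ∷ D ∷ D ∷ []) ∷ (b ∷ a ∷ B ∷ d ∷ []) ∷ (d ∷ a ∷ C ∷ D ∷ []) ∷ (C ∷ C ∷ D ∷ a ∷ []) ∷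
    (d ∷ d ∷ c ∷ a ∷ []) ∷ (c ∷ a ∷ B ∷ []) ∷ (a ∷ B ∷ C ∷ b ∷ []) ∷ (c ∷ B ∷ a ∷ []) ∷
    (a ∷ D ∷ C ∷ d ∷ []) ∷ (a ∷ B ∷ c ∷ []) ∷ (a ∷ b ∷ C ∷ B ∷ []) ∷ (b ∷ d ∷ a ∷ B ∷ []) ∷
    (C ∷ a ∷ []) ∷ (b ∷ d ∷ B ∷ a ∷ []) ∷ (a ∷ D ∷ B ∷ []) ∷ (C ∷ a ∷ c ∷ d ∷ []) ∷
    (a ∷ B ∷ D ∷ []) ∷ (C ∷ d ∷ a ∷ c ∷ []) ∷ (b ∷ C ∷ B ∷ a ∷ []) ∷ (A ∷ b ∷ b ∷ []) ∷
    (A ∷ c ∷ c ∷ b ∷ []) ∷ (b ∷ c ∷ A ∷ D ∷ []) ∷ (c ∷ d ∷ d ∷ a ∷ []) ∷ (a ∷ C ∷ d ∷ c ∷ []) ∷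
    (D ∷ a ∷ B ∷ []) ∷ (b ∷ D ∷ A ∷ c ∷ []) ∷ (D ∷ B ∷ a ∷ []) ∷ (a ∷ C ∷ D ∷ C ∷ []) ∷
    (A ∷ b ∷ D ∷ D ∷ []) ∷ (a ∷ a ∷ d ∷ A ∷ []) ∷ (a ∷ C ∷ []) ∷ (c ∷ b ∷ D ∷ A ∷ []) ∷
    (b ∷ D ∷ A ∷ D ∷ []) ∷ (a ∷ d ∷ []) ∷ (c ∷ c ∷ b ∷ A ∷ []) ∷ (B ∷ a ∷ c ∷ []) ∷
    (a ∷ d ∷ c ∷ d ∷ []) ∷ (b ∷ A ∷ b ∷ []) ∷ []
  ) ∷
  ( (b ∷ D ∷ c ∷ []) ∷ (b ∷ c ∷ c ∷ []) ∷ (c ∷ c ∷ c ∷ c ∷ []) ∷ (a ∷ D ∷ a ∷ B ∷ []) ∷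
    (C ∷ B ∷ B ∷ B ∷ []) ∷ (A ∷ B ∷ A ∷ []) ∷ (b ∷ a ∷ b ∷ A ∷ []) ∷ (b ∷ D ∷ D ∷ []) ∷
    (b ∷ c ∷ D ∷ []) ∷ (a ∷ a ∷ C ∷ []) ∷ (c ∷ a ∷ B ∷ a ∷ []) ∷ (b ∷ d ∷ c ∷ b ∷ []) ∷
    (a ∷ a ∷ d ∷ []) ∷ (A ∷ d ∷ C ∷ A ∷ []) ∷ (D ∷ c ∷ b ∷ []) ∷ (b ∷ C ∷ b ∷ D ∷ []) ∷
    (c ∷ b ∷ D ∷ []) ∷ (D ∷ c ∷ c ∷ c ∷ []) ∷ (a ∷ a ∷ c ∷ B ∷ []) ∷ (C ∷ b ∷ D ∷ b ∷ []) ∷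
    (a ∷ d ∷ a ∷ []) ∷ (a ∷ B ∷ a ∷ D ∷ []) ∷ (b ∷ c ∷ b ∷ C ∷ []) ∷ (A ∷ A ∷ C ∷ d ∷ []) ∷
    (D ∷ b ∷ c ∷ []) ∷ (b ∷ c ∷ b ∷ d ∷ []) ∷ (A ∷ d ∷ d ∷ A ∷ []) ∷ (d ∷ A ∷ C ∷ A ∷ []) ∷
    (b ∷ d ∷ b ∷ D ∷ []) ∷ (A ∷ A ∷ B ∷ []) ∷ (a ∷ c ∷ a ∷ B ∷ []) ∷ (D ∷ b ∷ D ∷ []) ∷
    (c ∷ D ∷ b ∷ []) ∷ (c ∷ b ∷ b ∷ d ∷ []) ∷ (a ∷ a ∷ B ∷ c ∷ []) ∷ (c ∷ D ∷ c ∷ c ∷ []) ∷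
    (d ∷ a ∷ a ∷ []) ∷ (a ∷ C ∷ a ∷ []) ∷ (d ∷ b ∷ b ∷ D ∷ []) ∷ (B ∷ A ∷ A ∷ []) ∷
    (d ∷ A ∷ d ∷ A ∷ []) ∷ (a ∷ a ∷ B ∷ D ∷ []) ∷ (c ∷ D ∷ c ∷ D ∷ []) ∷ (b ∷ D ∷ C ∷ b ∷ []) ∷
    (b ∷ b ∷ []) ∷ (c ∷ c ∷ b ∷ []) ∷ []
  ) ∷
  ( (C ∷ A ∷ c ∷ B ∷ []) ∷ (a ∷ d ∷ a ∷ a ∷ []) ∷ (a ∷ a ∷ C ∷ a ∷ []) ∷ (b ∷ b ∷ a ∷ []) ∷
    (a ∷ B ∷ A ∷ A ∷ []) ∷ (c ∷ b ∷ a ∷ D ∷ []) ∷ (D ∷ a ∷ D ∷ b ∷ []) ∷ (b ∷ D ∷ c ∷ a ∷ []) ∷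
    (A ∷ D ∷ B ∷ d ∷ []) ∷ (a ∷ b ∷ b ∷ []) ∷ (A ∷ d ∷ C ∷ []) ∷ (a ∷ b ∷ D ∷ c ∷ []) ∷
    (a ∷ b ∷ c ∷ c ∷ []) ∷ (A ∷ d ∷ d ∷ []) ∷ (A ∷ c ∷ B ∷ C ∷ []) ∷ (A ∷ C ∷ D ∷ B ∷ []) ∷
    (B ∷ A ∷ []) ∷ (d ∷ c ∷ B ∷ A ∷ []) ∷ (a ∷ b ∷ D ∷ D ∷ []) ∷ (b ∷ a ∷ b ∷ []) ∷
    (a ∷ a ∷ a ∷ C ∷ []) ∷ (b ∷ a ∷ D ∷ c ∷ []) ∷ (b ∷ a ∷ c ∷ c ∷ []) ∷ (C ∷ C ∷ A ∷ []) ∷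
    (d ∷ C ∷ A ∷ []) ∷ (a ∷ D ∷ c ∷ b ∷ []) ∷ (c ∷ B ∷ C ∷ A ∷ []) ∷ (a ∷ c ∷ b ∷ D ∷ []) ∷
    (b ∷ a ∷ D ∷ D ∷ []) ∷ (b ∷ a ∷ c ∷ D ∷ []) ∷ (B ∷ c ∷ A ∷ C ∷ []) ∷ (A ∷ C ∷ C ∷ []) ∷
    (b ∷ c ∷ c ∷ a ∷ []) ∷ (c ∷ d ∷ A ∷ B ∷ []) ∷ (A ∷ C ∷ d ∷ []) ∷ (a ∷ D ∷ b ∷ c ∷ []) ∷
    (C ∷ d ∷ A ∷ []) ∷ (d ∷ d ∷ A ∷ []) ∷ (d ∷ A ∷ C ∷ []) ∷ (c ∷ b ∷ D ∷ a ∷ []) ∷ (A ∷ B ∷ []) ∷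
    (d ∷ A ∷ d ∷ []) ∷ (a ∷ D ∷ b ∷ D ∷ []) ∷ (a ∷ c ∷ D ∷ b ∷ []) ∷ (b ∷ D ∷ D ∷ a ∷ []) ∷
    (c ∷ a ∷ D ∷ b ∷ []) ∷ []
  ) ∷
  ( (B ∷ C ∷ D ∷ []) ∷ (A ∷ A ∷ b ∷ D ∷ []) ∷ (c ∷ d ∷ B ∷ []) ∷ (B ∷ B ∷ c ∷ D ∷ []) ∷
    (D ∷ B ∷ C ∷ []) ∷ (b ∷ D ∷ A ∷ A ∷ []) ∷ (c ∷ A ∷ A ∷ b ∷ []) ∷ (D ∷ B ∷ d ∷ []) ∷
    (a ∷ a ∷ b ∷ b ∷ []) ∷ (d ∷ C ∷ []) ∷ (b ∷ A ∷ c ∷ A ∷ []) ∷ (D ∷ c ∷ B ∷ B ∷ []) ∷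
    (d ∷ d ∷ []) ∷ (c ∷ B ∷ C ∷ []) ∷ (C ∷ D ∷ B ∷ []) ∷ (a ∷ B ∷ A ∷ []) ∷ (c ∷ B ∷ d ∷ []) ∷
    (A ∷ A ∷ D ∷ b ∷ []) ∷ (d ∷ c ∷ B ∷ []) ∷ (b ∷ A ∷ A ∷ D ∷ []) ∷ (c ∷ c ∷ B ∷ B ∷ []) ∷
    (b ∷ C ∷ d ∷ B ∷ []) ∷ (a ∷ C ∷ C ∷ A ∷ []) ∷ (a ∷ d ∷ C ∷ A ∷ []) ∷ (D ∷ C ∷ C ∷ d ∷ []) ∷
    (b ∷ A ∷ D ∷ A ∷ []) ∷ (C ∷ d ∷ d ∷ c ∷ []) ∷ (A ∷ d ∷ C ∷ a ∷ []) ∷ (D ∷ D ∷ B ∷ B ∷ []) ∷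
    (A ∷ C ∷ d ∷ a ∷ []) ∷ (C ∷ C ∷ []) ∷ (d ∷ B ∷ C ∷ b ∷ []) ∷ (B ∷ d ∷ c ∷ []) ∷ (C ∷ d ∷ []) ∷
    (d ∷ B ∷ c ∷ []) ∷ (a ∷ C ∷ d ∷ A ∷ []) ∷ (B ∷ D ∷ C ∷ []) ∷ (a ∷ d ∷ A ∷ C ∷ []) ∷
    (b ∷ a ∷ a ∷ b ∷ []) ∷ (B ∷ []) ∷ (a ∷ d ∷ A ∷ d ∷ []) ∷ (d ∷ B ∷ D ∷ []) ∷ (B ∷ c ∷ d ∷ []) ∷
    (c ∷ B ∷ D ∷ B ∷ []) ∷ (d ∷ b ∷ d ∷ B ∷ []) ∷ (c ∷ B ∷ B ∷ D ∷ []) ∷ []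
  ) ∷
  ( (C ∷ b ∷ A ∷ b ∷ []) ∷ (b ∷ d ∷ b ∷ A ∷ []) ∷ (d ∷ C ∷ a ∷ []) ∷ (D ∷ A ∷ D ∷ D ∷ []) ∷
    (C ∷ d ∷ a ∷ []) ∷ (a ∷ C ∷ C ∷ []) ∷ (d ∷ a ∷ B ∷ D ∷ []) ∷ (a ∷ B ∷ d ∷ c ∷ []) ∷
    (a ∷ C ∷ d ∷ []) ∷ (a ∷ d ∷ B ∷ c ∷ []) ∷ (c ∷ c ∷ c ∷ A ∷ []) ∷ (a ∷ B ∷ D ∷ C ∷ []) ∷
    (b ∷ C ∷ b ∷ A ∷ []) ∷ (A ∷ b ∷ d ∷ b ∷ []) ∷ (a ∷ B ∷ []) ∷ (A ∷ b ∷ c ∷ []) ∷ (B ∷ a ∷ []) ∷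
    (a ∷ B ∷ c ∷ d ∷ []) ∷ (C ∷ a ∷ B ∷ c ∷ []) ∷ (c ∷ c ∷ A ∷ D ∷ []) ∷ (d ∷ a ∷ C ∷ []) ∷
    (C ∷ C ∷ a ∷ []) ∷ (A ∷ b ∷ D ∷ []) ∷ (d ∷ a ∷ d ∷ []) ∷ (b ∷ b ∷ C ∷ A ∷ []) ∷
    (b ∷ c ∷ A ∷ []) ∷ (D ∷ D ∷ c ∷ A ∷ []) ∷ (b ∷ A ∷ c ∷ []) ∷ (a ∷ D ∷ B ∷ d ∷ []) ∷
    (d ∷ a ∷ c ∷ B ∷ []) ∷ (a ∷ d ∷ C ∷ []) ∷ (d ∷ d ∷ a ∷ []) ∷ (d ∷ B ∷ a ∷ D ∷ []) ∷
    (a ∷ d ∷ d ∷ []) ∷ (b ∷ A ∷ D ∷ []) ∷ (c ∷ A ∷ b ∷ []) ∷ (a ∷ a ∷ B ∷ A ∷ []) ∷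
    (a ∷ c ∷ B ∷ d ∷ []) ∷ (A ∷ D ∷ b ∷ []) ∷ (C ∷ a ∷ C ∷ []) ∷ (b ∷ D ∷ A ∷ []) ∷
    (b ∷ b ∷ A ∷ d ∷ []) ∷ (C ∷ a ∷ d ∷ []) ∷ (c ∷ b ∷ A ∷ []) ∷ (c ∷ A ∷ D ∷ D ∷ []) ∷
    (c ∷ a ∷ B ∷ d ∷ []) ∷ []
  ) ∷
  ( (a ∷ b ∷ A ∷ c ∷ []) ∷ (b ∷ a ∷ D ∷ A ∷ []) ∷ (b ∷ D ∷ C ∷ D ∷ []) ∷ (a ∷ a ∷ d ∷ C ∷ []) ∷
    (a ∷ d ∷ d ∷ a ∷ []) ∷ (c ∷ c ∷ b ∷ d ∷ []) ∷ (a ∷ a ∷ d ∷ d ∷ []) ∷ (a ∷ b ∷ A ∷ D ∷ []) ∷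
    (d ∷ b ∷ b ∷ []) ∷ (b ∷ b ∷ C ∷ []) ∷ (d ∷ b ∷ D ∷ c ∷ []) ∷ (D ∷ b ∷ []) ∷ (b ∷ b ∷ d ∷ []) ∷
    (D ∷ D ∷ c ∷ []) ∷ (D ∷ c ∷ c ∷ []) ∷ (a ∷ C ∷ a ∷ d ∷ []) ∷ (a ∷ c ∷ b ∷ A ∷ []) ∷
    (c ∷ b ∷ d ∷ c ∷ []) ∷ (b ∷ b ∷ c ∷ B ∷ []) ∷ (d ∷ a ∷ a ∷ C ∷ []) ∷ (D ∷ D ∷ D ∷ []) ∷
    (D ∷ c ∷ D ∷ []) ∷ (d ∷ a ∷ a ∷ d ∷ []) ∷ (C ∷ b ∷ b ∷ []) ∷ (c ∷ b ∷ []) ∷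
    (c ∷ c ∷ d ∷ b ∷ []) ∷ (c ∷ D ∷ c ∷ []) ∷ (c ∷ c ∷ c ∷ []) ∷ (A ∷ C ∷ B ∷ A ∷ []) ∷
    (b ∷ A ∷ D ∷ a ∷ []) ∷ (d ∷ a ∷ d ∷ a ∷ []) ∷ (b ∷ C ∷ b ∷ []) ∷ (b ∷ d ∷ b ∷ []) ∷
    (a ∷ a ∷ B ∷ []) ∷ (b ∷ c ∷ []) ∷ (a ∷ B ∷ a ∷ []) ∷ (B ∷ c ∷ b ∷ b ∷ []) ∷
    (b ∷ c ∷ c ∷ d ∷ []) ∷ (b ∷ A ∷ c ∷ a ∷ []) ∷ (B ∷ a ∷ a ∷ []) ∷ (a ∷ C ∷ C ∷ a ∷ []) ∷
    (b ∷ D ∷ []) ∷ (a ∷ d ∷ a ∷ d ∷ []) ∷ (B ∷ A ∷ d ∷ A ∷ []) ∷ (a ∷ b ∷ c ∷ A ∷ []) ∷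
    (A ∷ d ∷ A ∷ B ∷ []) ∷ []
  ) ∷
  ( (a ∷ b ∷ C ∷ b ∷ []) ∷ (a ∷ b ∷ d ∷ b ∷ []) ∷ (a ∷ a ∷ a ∷ B ∷ []) ∷ (a ∷ b ∷ c ∷ []) ∷
    (a ∷ a ∷ B ∷ a ∷ []) ∷ (d ∷ A ∷ C ∷ C ∷ []) ∷ (D ∷ b ∷ a ∷ []) ∷ (B ∷ C ∷ A ∷ []) ∷
    (a ∷ B ∷ a ∷ a ∷ []) ∷ (c ∷ b ∷ a ∷ []) ∷ (a ∷ b ∷ D ∷ []) ∷ (d ∷ d ∷ d ∷ A ∷ []) ∷
    (d ∷ d ∷ A ∷ C ∷ []) ∷ (c ∷ D ∷ c ∷ a ∷ []) ∷ (d ∷ A ∷ B ∷ []) ∷ (d ∷ d ∷ A ∷ d ∷ []) ∷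
    (b ∷ C ∷ a ∷ b ∷ []) ∷ (A ∷ C ∷ B ∷ []) ∷ (C ∷ d ∷ d ∷ A ∷ []) ∷ (C ∷ d ∷ A ∷ C ∷ []) ∷
    (b ∷ D ∷ a ∷ []) ∷ (B ∷ A ∷ C ∷ []) ∷ (D ∷ a ∷ b ∷ []) ∷ (a ∷ d ∷ b ∷ b ∷ []) ∷
    (B ∷ A ∷ d ∷ []) ∷ (b ∷ a ∷ c ∷ []) ∷ (a ∷ D ∷ b ∷ []) ∷ (a ∷ b ∷ b ∷ d ∷ []) ∷
    (a ∷ D ∷ D ∷ c ∷ []) ∷ (b ∷ c ∷ a ∷ []) ∷ (d ∷ A ∷ d ∷ C ∷ []) ∷ (b ∷ b ∷ d ∷ a ∷ []) ∷
    (b ∷ a ∷ D ∷ []) ∷ (d ∷ A ∷ d ∷ d ∷ []) ∷ (c ∷ a ∷ D ∷ D ∷ []) ∷ (a ∷ D ∷ D ∷ D ∷ []) ∷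
    (d ∷ B ∷ A ∷ []) ∷ (A ∷ B ∷ C ∷ []) ∷ (a ∷ C ∷ b ∷ b ∷ []) ∷ (a ∷ c ∷ b ∷ []) ∷
    (A ∷ B ∷ d ∷ []) ∷ (a ∷ c ∷ D ∷ c ∷ []) ∷ (a ∷ c ∷ c ∷ c ∷ []) ∷ (C ∷ B ∷ A ∷ []) ∷
    (b ∷ A ∷ A ∷ A ∷ []) ∷ (A ∷ d ∷ d ∷ d ∷ []) ∷ []
  ) ∷
  ( (a ∷ a ∷ c ∷ b ∷ []) ∷ (B ∷ d ∷ []) ∷ (c ∷ b ∷ a ∷ a ∷ []) ∷ (b ∷ A ∷ A ∷ []) ∷
    (a ∷ C ∷ B ∷ A ∷ []) ∷ (c ∷ B ∷ B ∷ []) ∷ (d ∷ d ∷ d ∷ []) ∷ (B ∷ c ∷ B ∷ []) ∷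
    (b ∷ b ∷ b ∷ b ∷ []) ∷ (d ∷ a ∷ B ∷ A ∷ []) ∷ (a ∷ a ∷ b ∷ c ∷ []) ∷ (A ∷ d ∷ a ∷ B ∷ []) ∷
    (d ∷ d ∷ c ∷ B ∷ []) ∷ (a ∷ D ∷ b ∷ a ∷ []) ∷ (a ∷ B ∷ C ∷ A ∷ []) ∷ (C ∷ C ∷ C ∷ []) ∷
    (a ∷ c ∷ b ∷ a ∷ []) ∷ (a ∷ a ∷ b ∷ D ∷ []) ∷ (C ∷ C ∷ d ∷ []) ∷ (B ∷ D ∷ C ∷ C ∷ []) ∷
    (B ∷ B ∷ C ∷ b ∷ []) ∷ (a ∷ d ∷ A ∷ B ∷ []) ∷ (D ∷ B ∷ B ∷ []) ∷ (B ∷ B ∷ c ∷ []) ∷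
    (C ∷ B ∷ []) ∷ (b ∷ a ∷ D ∷ a ∷ []) ∷ (d ∷ B ∷ d ∷ c ∷ []) ∷ (d ∷ C ∷ d ∷ []) ∷
    (B ∷ D ∷ B ∷ []) ∷ (a ∷ D ∷ a ∷ b ∷ []) ∷ (B ∷ B ∷ D ∷ []) ∷ (a ∷ B ∷ A ∷ d ∷ []) ∷
    (a ∷ b ∷ a ∷ c ∷ []) ∷ (d ∷ B ∷ []) ∷ (b ∷ a ∷ c ∷ a ∷ []) ∷ (d ∷ d ∷ B ∷ D ∷ []) ∷
    (a ∷ b ∷ c ∷ a ∷ []) ∷ (A ∷ A ∷ b ∷ []) ∷ (A ∷ D ∷ D ∷ A ∷ []) ∷ (a ∷ b ∷ a ∷ D ∷ []) ∷
    (C ∷ d ∷ C ∷ []) ∷ (A ∷ B ∷ d ∷ a ∷ []) ∷ (b ∷ c ∷ a ∷ a ∷ []) ∷ (C ∷ d ∷ d ∷ []) ∷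
    (B ∷ C ∷ []) ∷ (A ∷ b ∷ A ∷ []) ∷ []
  ) ∷
  ( (B ∷ a ∷ B ∷ c ∷ []) ∷ (C ∷ a ∷ C ∷ d ∷ []) ∷ (d ∷ a ∷ B ∷ []) ∷ (c ∷ c ∷ A ∷ []) ∷
    (d ∷ B ∷ a ∷ []) ∷ (c ∷ A ∷ c ∷ []) ∷ (a ∷ C ∷ C ∷ C ∷ []) ∷ (C ∷ a ∷ B ∷ []) ∷
    (d ∷ d ∷ a ∷ C ∷ []) ∷ (C ∷ B ∷ a ∷ []) ∷ (d ∷ A ∷ b ∷ D ∷ []) ∷ (d ∷ d ∷ a ∷ d ∷ []) ∷
    (c ∷ A ∷ D ∷ []) ∷ (a ∷ D ∷ B ∷ B ∷ []) ∷ (D ∷ c ∷ A ∷ []) ∷ (a ∷ C ∷ B ∷ []) ∷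
    (D ∷ A ∷ c ∷ []) ∷ (c ∷ d ∷ A ∷ b ∷ []) ∷ (c ∷ D ∷ A ∷ []) ∷ (a ∷ B ∷ D ∷ B ∷ []) ∷
    (C ∷ b ∷ A ∷ c ∷ []) ∷ (B ∷ a ∷ C ∷ []) ∷ (d ∷ b ∷ A ∷ D ∷ []) ∷ (D ∷ A ∷ D ∷ []) ∷
    (a ∷ d ∷ B ∷ []) ∷ (c ∷ d ∷ b ∷ A ∷ []) ∷ (c ∷ A ∷ b ∷ C ∷ []) ∷ (d ∷ C ∷ a ∷ C ∷ []) ∷
    (A ∷ b ∷ []) ∷ (D ∷ D ∷ A ∷ []) ∷ (A ∷ D ∷ c ∷ []) ∷ (A ∷ c ∷ c ∷ []) ∷ (B ∷ d ∷ a ∷ []) ∷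
    (b ∷ A ∷ D ∷ C ∷ []) ∷ (a ∷ C ∷ d ∷ d ∷ []) ∷ (a ∷ B ∷ C ∷ []) ∷ (b ∷ A ∷ []) ∷
    (A ∷ D ∷ D ∷ []) ∷ (a ∷ B ∷ d ∷ []) ∷ (b ∷ A ∷ c ∷ d ∷ []) ∷ (a ∷ b ∷ A ∷ A ∷ []) ∷
    (A ∷ d ∷ c ∷ b ∷ []) ∷ (a ∷ c ∷ B ∷ B ∷ []) ∷ (a ∷ d ∷ d ∷ d ∷ []) ∷ (a ∷ B ∷ c ∷ B ∷ []) ∷
    (b ∷ C ∷ A ∷ D ∷ []) ∷ []
  ) ∷
  ( (d ∷ c ∷ b ∷ []) ∷ (b ∷ d ∷ b ∷ C ∷ []) ∷ (d ∷ c ∷ D ∷ c ∷ []) ∷ (b ∷ b ∷ d ∷ C ∷ []) ∷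
    (C ∷ b ∷ D ∷ []) ∷ (B ∷ c ∷ b ∷ D ∷ []) ∷ (b ∷ b ∷ d ∷ d ∷ []) ∷ (a ∷ d ∷ a ∷ B ∷ []) ∷
    (a ∷ c ∷ c ∷ A ∷ []) ∷ (a ∷ d ∷ B ∷ a ∷ []) ∷ (d ∷ b ∷ c ∷ []) ∷ (c ∷ b ∷ C ∷ []) ∷
    (a ∷ C ∷ a ∷ B ∷ []) ∷ (D ∷ b ∷ d ∷ []) ∷ (c ∷ b ∷ d ∷ []) ∷ (d ∷ B ∷ a ∷ a ∷ []) ∷
    (b ∷ D ∷ B ∷ D ∷ []) ∷ (d ∷ b ∷ D ∷ []) ∷ (B ∷ A ∷ A ∷ B ∷ []) ∷ (a ∷ D ∷ c ∷ A ∷ []) ∷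
    (C ∷ D ∷ b ∷ []) ∷ (a ∷ D ∷ A ∷ c ∷ []) ∷ (C ∷ D ∷ D ∷ c ∷ []) ∷ (a ∷ c ∷ D ∷ A ∷ []) ∷
    (b ∷ b ∷ C ∷ C ∷ []) ∷ (B ∷ d ∷ a ∷ a ∷ []) ∷ (b ∷ d ∷ c ∷ []) ∷ (b ∷ b ∷ C ∷ d ∷ []) ∷
    (a ∷ D ∷ A ∷ D ∷ []) ∷ (a ∷ a ∷ d ∷ B ∷ []) ∷ (b ∷ D ∷ C ∷ []) ∷ (b ∷ C ∷ d ∷ b ∷ []) ∷
    (D ∷ C ∷ b ∷ []) ∷ (b ∷ []) ∷ (c ∷ d ∷ b ∷ []) ∷ (D ∷ c ∷ []) ∷ (c ∷ c ∷ []) ∷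
    (a ∷ B ∷ d ∷ a ∷ []) ∷ (D ∷ c ∷ c ∷ d ∷ []) ∷ (b ∷ D ∷ c ∷ B ∷ []) ∷ (b ∷ C ∷ D ∷ []) ∷
    (a ∷ b ∷ A ∷ []) ∷ (D ∷ D ∷ []) ∷ (c ∷ D ∷ []) ∷ (c ∷ d ∷ c ∷ D ∷ []) ∷ (d ∷ C ∷ b ∷ b ∷ []) ∷ []
  ) ∷
  ( (a ∷ D ∷ b ∷ d ∷ []) ∷ (a ∷ c ∷ b ∷ d ∷ []) ∷ (b ∷ b ∷ a ∷ B ∷ []) ∷ (A ∷ C ∷ d ∷ B ∷ []) ∷
    (b ∷ a ∷ []) ∷ (d ∷ B ∷ C ∷ A ∷ []) ∷ (c ∷ b ∷ C ∷ a ∷ []) ∷ (a ∷ C ∷ D ∷ b ∷ []) ∷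
    (D ∷ c ∷ a ∷ []) ∷ (b ∷ d ∷ a ∷ c ∷ []) ∷ (B ∷ a ∷ b ∷ b ∷ []) ∷ (D ∷ a ∷ D ∷ []) ∷
    (d ∷ d ∷ A ∷ B ∷ []) ∷ (a ∷ b ∷ d ∷ c ∷ []) ∷ (A ∷ c ∷ A ∷ A ∷ []) ∷ (d ∷ A ∷ C ∷ B ∷ []) ∷
    (b ∷ d ∷ a ∷ D ∷ []) ∷ (B ∷ B ∷ A ∷ []) ∷ (d ∷ b ∷ D ∷ a ∷ []) ∷ (a ∷ D ∷ C ∷ b ∷ []) ∷
    (a ∷ b ∷ []) ∷ (A ∷ B ∷ B ∷ []) ∷ (a ∷ D ∷ c ∷ []) ∷ (a ∷ c ∷ c ∷ []) ∷ (c ∷ D ∷ a ∷ []) ∷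
    (b ∷ c ∷ a ∷ d ∷ []) ∷ (c ∷ a ∷ C ∷ b ∷ []) ∷ (a ∷ b ∷ C ∷ D ∷ []) ∷ (a ∷ a ∷ b ∷ A ∷ []) ∷
    (a ∷ D ∷ D ∷ []) ∷ (a ∷ c ∷ D ∷ []) ∷ (C ∷ d ∷ B ∷ A ∷ []) ∷ (A ∷ d ∷ d ∷ B ∷ []) ∷
    (c ∷ c ∷ a ∷ []) ∷ (d ∷ d ∷ B ∷ A ∷ []) ∷ (c ∷ b ∷ d ∷ a ∷ []) ∷ (c ∷ a ∷ D ∷ []) ∷
    (a ∷ C ∷ b ∷ D ∷ []) ∷ (d ∷ A ∷ B ∷ d ∷ []) ∷ (b ∷ D ∷ a ∷ C ∷ []) ∷ (A ∷ A ∷ A ∷ c ∷ []) ∷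
    (B ∷ A ∷ B ∷ []) ∷ (b ∷ D ∷ a ∷ d ∷ []) ∷ (a ∷ d ∷ b ∷ c ∷ []) ∷ (a ∷ c ∷ b ∷ C ∷ []) ∷
    (D ∷ D ∷ a ∷ []) ∷ []
  ) ∷
  ( (C ∷ d ∷ B ∷ []) ∷ (a ∷ b ∷ a ∷ []) ∷ (d ∷ d ∷ d ∷ d ∷ []) ∷ (d ∷ B ∷ c ∷ B ∷ []) ∷
    (A ∷ D ∷ A ∷ []) ∷ (a ∷ D ∷ c ∷ a ∷ []) ∷ (b ∷ A ∷ C ∷ A ∷ []) ∷ (C ∷ C ∷ d ∷ C ∷ []) ∷
    (a ∷ D ∷ a ∷ D ∷ []) ∷ (B ∷ C ∷ C ∷ []) ∷ (b ∷ b ∷ b ∷ c ∷ []) ∷ (c ∷ A ∷ A ∷ []) ∷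
    (B ∷ C ∷ d ∷ []) ∷ (B ∷ d ∷ B ∷ c ∷ []) ∷ (C ∷ B ∷ d ∷ []) ∷ (b ∷ a ∷ a ∷ []) ∷
    (c ∷ b ∷ b ∷ b ∷ []) ∷ (a ∷ a ∷ b ∷ []) ∷ (B ∷ B ∷ []) ∷ (a ∷ a ∷ D ∷ c ∷ []) ∷
    (d ∷ C ∷ B ∷ []) ∷ (a ∷ c ∷ D ∷ a ∷ []) ∷ (b ∷ C ∷ A ∷ A ∷ []) ∷ (b ∷ A ∷ A ∷ d ∷ []) ∷
    (d ∷ B ∷ D ∷ B ∷ []) ∷ (B ∷ B ∷ C ∷ D ∷ []) ∷ (a ∷ a ∷ D ∷ D ∷ []) ∷ (a ∷ a ∷ c ∷ D ∷ []) ∷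
    (C ∷ C ∷ C ∷ C ∷ []) ∷ (d ∷ d ∷ B ∷ []) ∷ (D ∷ A ∷ A ∷ []) ∷ (C ∷ C ∷ C ∷ d ∷ []) ∷
    (c ∷ B ∷ C ∷ B ∷ []) ∷ (a ∷ c ∷ a ∷ D ∷ []) ∷ (B ∷ d ∷ C ∷ []) ∷ (A ∷ c ∷ A ∷ []) ∷
    (d ∷ C ∷ d ∷ C ∷ []) ∷ (A ∷ A ∷ c ∷ []) ∷ (a ∷ B ∷ A ∷ B ∷ []) ∷ (d ∷ C ∷ d ∷ d ∷ []) ∷
    (d ∷ B ∷ C ∷ []) ∷ (c ∷ B ∷ d ∷ B ∷ []) ∷ (a ∷ D ∷ D ∷ a ∷ []) ∷ (d ∷ B ∷ d ∷ []) ∷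
    (A ∷ A ∷ D ∷ []) ∷ (c ∷ a ∷ a ∷ D ∷ []) ∷ []
  ) ∷
  ( (a ∷ d ∷ d ∷ B ∷ []) ∷ (a ∷ D ∷ A ∷ A ∷ []) ∷ (B ∷ C ∷ C ∷ a ∷ []) ∷ (b ∷ A ∷ D ∷ B ∷ []) ∷
    (d ∷ c ∷ A ∷ D ∷ []) ∷ (b ∷ C ∷ A ∷ []) ∷ (c ∷ A ∷ []) ∷ (c ∷ D ∷ A ∷ C ∷ []) ∷ (A ∷ c ∷ []) ∷
    (c ∷ A ∷ c ∷ d ∷ []) ∷ (c ∷ D ∷ A ∷ d ∷ []) ∷ (a ∷ d ∷ B ∷ C ∷ []) ∷ (A ∷ A ∷ c ∷ a ∷ []) ∷
    (c ∷ A ∷ C ∷ D ∷ []) ∷ (a ∷ d ∷ B ∷ d ∷ []) ∷ (A ∷ D ∷ []) ∷ (d ∷ a ∷ d ∷ B ∷ []) ∷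
    (a ∷ C ∷ d ∷ B ∷ []) ∷ (b ∷ d ∷ A ∷ []) ∷ (b ∷ A ∷ C ∷ []) ∷ (d ∷ A ∷ b ∷ []) ∷ (D ∷ A ∷ []) ∷
    (b ∷ A ∷ d ∷ []) ∷ (c ∷ c ∷ A ∷ d ∷ []) ∷ (d ∷ B ∷ d ∷ a ∷ []) ∷ (D ∷ D ∷ A ∷ d ∷ []) ∷
    (a ∷ B ∷ C ∷ C ∷ []) ∷ (d ∷ a ∷ B ∷ C ∷ []) ∷ (d ∷ b ∷ A ∷ []) ∷ (A ∷ b ∷ C ∷ []) ∷
    (c ∷ b ∷ A ∷ B ∷ []) ∷ (C ∷ A ∷ b ∷ []) ∷ (A ∷ b ∷ d ∷ []) ∷ (C ∷ A ∷ D ∷ c ∷ []) ∷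
    (a ∷ a ∷ a ∷ b ∷ []) ∷ (a ∷ B ∷ B ∷ []) ∷ (D ∷ C ∷ D ∷ A ∷ []) ∷ (a ∷ d ∷ C ∷ B ∷ []) ∷
    (A ∷ b ∷ c ∷ B ∷ []) ∷ (C ∷ b ∷ A ∷ []) ∷ (d ∷ d ∷ a ∷ B ∷ []) ∷ (B ∷ a ∷ B ∷ []) ∷
    (d ∷ d ∷ B ∷ a ∷ []) ∷ (B ∷ B ∷ a ∷ []) ∷ (b ∷ c ∷ B ∷ A ∷ []) ∷ (c ∷ A ∷ d ∷ c ∷ []) ∷ []
  ) ∷
  ( (a ∷ a ∷ B ∷ B ∷ []) ∷ (b ∷ C ∷ C ∷ D ∷ []) ∷ (c ∷ D ∷ B ∷ D ∷ []) ∷ (b ∷ c ∷ B ∷ []) ∷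
    (a ∷ C ∷ b ∷ A ∷ []) ∷ (b ∷ A ∷ d ∷ a ∷ []) ∷ (a ∷ B ∷ a ∷ B ∷ []) ∷ (D ∷ D ∷ D ∷ B ∷ []) ∷
    (a ∷ B ∷ B ∷ a ∷ []) ∷ (B ∷ c ∷ b ∷ []) ∷ (c ∷ b ∷ C ∷ C ∷ []) ∷ (B ∷ c ∷ D ∷ c ∷ []) ∷
    (c ∷ d ∷ c ∷ []) ∷ (c ∷ b ∷ C ∷ d ∷ []) ∷ (A ∷ D ∷ a ∷ []) ∷ (b ∷ D ∷ C ∷ C ∷ []) ∷
    (C ∷ b ∷ []) ∷ (d ∷ b ∷ []) ∷ (C ∷ D ∷ c ∷ []) ∷ (c ∷ []) ∷ (d ∷ c ∷ c ∷ []) ∷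
    (c ∷ B ∷ D ∷ c ∷ []) ∷ (c ∷ c ∷ d ∷ []) ∷ (A ∷ c ∷ a ∷ []) ∷ (b ∷ D ∷ B ∷ []) ∷
    (C ∷ D ∷ D ∷ []) ∷ (D ∷ []) ∷ (d ∷ c ∷ D ∷ []) ∷ (c ∷ c ∷ c ∷ B ∷ []) ∷ (D ∷ c ∷ d ∷ []) ∷
    (a ∷ b ∷ A ∷ C ∷ []) ∷ (a ∷ d ∷ A ∷ b ∷ []) ∷ (a ∷ D ∷ A ∷ []) ∷ (D ∷ C ∷ D ∷ []) ∷
    (d ∷ C ∷ b ∷ D ∷ []) ∷ (c ∷ b ∷ d ∷ C ∷ []) ∷ (b ∷ d ∷ d ∷ c ∷ []) ∷ (b ∷ C ∷ D ∷ C ∷ []) ∷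
    (c ∷ b ∷ d ∷ d ∷ []) ∷ (a ∷ d ∷ b ∷ A ∷ []) ∷ (b ∷ C ∷ []) ∷ (c ∷ D ∷ B ∷ c ∷ []) ∷
    (B ∷ D ∷ b ∷ []) ∷ (b ∷ d ∷ []) ∷ (c ∷ c ∷ B ∷ c ∷ []) ∷ (B ∷ D ∷ c ∷ c ∷ []) ∷ []
  ) ∷
  ( (B ∷ B ∷ C ∷ A ∷ []) ∷ (d ∷ c ∷ c ∷ a ∷ []) ∷ (a ∷ b ∷ c ∷ B ∷ []) ∷ (B ∷ a ∷ b ∷ D ∷ []) ∷
    (d ∷ c ∷ a ∷ D ∷ []) ∷ (c ∷ c ∷ d ∷ a ∷ []) ∷ (C ∷ B ∷ B ∷ A ∷ []) ∷ (b ∷ D ∷ a ∷ B ∷ []) ∷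
    (a ∷ B ∷ c ∷ b ∷ []) ∷ (C ∷ a ∷ b ∷ []) ∷ (B ∷ A ∷ C ∷ B ∷ []) ∷ (a ∷ c ∷ d ∷ c ∷ []) ∷
    (A ∷ B ∷ C ∷ B ∷ []) ∷ (D ∷ a ∷ []) ∷ (c ∷ D ∷ a ∷ d ∷ []) ∷ (a ∷ C ∷ b ∷ []) ∷
    (a ∷ d ∷ b ∷ []) ∷ (a ∷ C ∷ D ∷ c ∷ []) ∷ (a ∷ c ∷ []) ∷ (a ∷ d ∷ c ∷ c ∷ []) ∷
    (b ∷ b ∷ A ∷ b ∷ []) ∷ (a ∷ c ∷ c ∷ d ∷ []) ∷ (c ∷ a ∷ []) ∷ (a ∷ b ∷ D ∷ B ∷ []) ∷
    (b ∷ d ∷ a ∷ []) ∷ (a ∷ D ∷ []) ∷ (a ∷ d ∷ c ∷ D ∷ []) ∷ (c ∷ d ∷ a ∷ c ∷ []) ∷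
    (a ∷ D ∷ c ∷ d ∷ []) ∷ (c ∷ a ∷ C ∷ D ∷ []) ∷ (A ∷ c ∷ a ∷ a ∷ []) ∷ (a ∷ a ∷ D ∷ A ∷ []) ∷
    (a ∷ D ∷ C ∷ D ∷ []) ∷ (B ∷ A ∷ B ∷ d ∷ []) ∷ (d ∷ a ∷ b ∷ []) ∷ (d ∷ A ∷ B ∷ B ∷ []) ∷
    (b ∷ c ∷ B ∷ a ∷ []) ∷ (A ∷ A ∷ A ∷ []) ∷ (b ∷ a ∷ B ∷ c ∷ []) ∷ (a ∷ b ∷ C ∷ []) ∷
    (c ∷ c ∷ a ∷ C ∷ []) ∷ (b ∷ C ∷ a ∷ []) ∷ (a ∷ b ∷ d ∷ []) ∷ (b ∷ a ∷ D ∷ B ∷ []) ∷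
    (d ∷ a ∷ c ∷ D ∷ []) ∷ (b ∷ a ∷ B ∷ D ∷ []) ∷ []
  ) ∷
  ( (a ∷ a ∷ D ∷ []) ∷ (C ∷ C ∷ d ∷ B ∷ []) ∷ (b ∷ A ∷ A ∷ B ∷ []) ∷ (B ∷ C ∷ d ∷ C ∷ []) ∷
    (b ∷ D ∷ b ∷ D ∷ []) ∷ (c ∷ a ∷ a ∷ []) ∷ (A ∷ d ∷ A ∷ D ∷ []) ∷ (B ∷ B ∷ C ∷ []) ∷
    (c ∷ B ∷ B ∷ B ∷ []) ∷ (a ∷ d ∷ a ∷ b ∷ []) ∷ (B ∷ B ∷ d ∷ []) ∷ (d ∷ d ∷ d ∷ B ∷ []) ∷
    (A ∷ A ∷ []) ∷ (c ∷ A ∷ A ∷ d ∷ []) ∷ (a ∷ a ∷ b ∷ C ∷ []) ∷ (A ∷ A ∷ c ∷ d ∷ []) ∷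
    (a ∷ b ∷ C ∷ a ∷ []) ∷ (b ∷ b ∷ b ∷ []) ∷ (b ∷ c ∷ c ∷ b ∷ []) ∷ (C ∷ B ∷ B ∷ []) ∷
    (b ∷ b ∷ c ∷ c ∷ []) ∷ (A ∷ C ∷ A ∷ D ∷ []) ∷ (d ∷ d ∷ B ∷ C ∷ []) ∷ (c ∷ b ∷ D ∷ b ∷ []) ∷
    (b ∷ A ∷ B ∷ A ∷ []) ∷ (d ∷ d ∷ B ∷ d ∷ []) ∷ (b ∷ b ∷ D ∷ D ∷ []) ∷ (b ∷ b ∷ c ∷ D ∷ []) ∷
    (b ∷ a ∷ a ∷ C ∷ []) ∷ (d ∷ a ∷ b ∷ a ∷ []) ∷ (a ∷ C ∷ a ∷ b ∷ []) ∷ (b ∷ a ∷ a ∷ d ∷ []) ∷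
    (d ∷ A ∷ D ∷ A ∷ []) ∷ (B ∷ C ∷ B ∷ []) ∷ (a ∷ D ∷ a ∷ []) ∷ (b ∷ c ∷ b ∷ D ∷ []) ∷
    (a ∷ a ∷ C ∷ b ∷ []) ∷ (a ∷ a ∷ d ∷ b ∷ []) ∷ (C ∷ A ∷ A ∷ c ∷ []) ∷ (a ∷ a ∷ c ∷ []) ∷
    (d ∷ B ∷ C ∷ d ∷ []) ∷ (C ∷ d ∷ B ∷ C ∷ []) ∷ (B ∷ d ∷ B ∷ []) ∷ (a ∷ c ∷ a ∷ []) ∷
    (C ∷ d ∷ B ∷ d ∷ []) ∷ (a ∷ b ∷ d ∷ a ∷ []) ∷ []
  ) ∷
  ( (C ∷ D ∷ A ∷ []) ∷ (c ∷ B ∷ D ∷ A ∷ []) ∷ (c ∷ A ∷ d ∷ []) ∷ (b ∷ A ∷ C ∷ d ∷ []) ∷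
    (A ∷ b ∷ d ∷ d ∷ []) ∷ (b ∷ C ∷ d ∷ A ∷ []) ∷ (a ∷ B ∷ C ∷ B ∷ []) ∷ (a ∷ a ∷ D ∷ a ∷ []) ∷
    (c ∷ A ∷ c ∷ B ∷ []) ∷ (b ∷ A ∷ B ∷ []) ∷ (b ∷ d ∷ A ∷ d ∷ []) ∷ (B ∷ D ∷ A ∷ c ∷ []) ∷
    (a ∷ a ∷ a ∷ c ∷ []) ∷ (B ∷ c ∷ D ∷ A ∷ []) ∷ (A ∷ D ∷ B ∷ D ∷ []) ∷ (a ∷ B ∷ d ∷ B ∷ []) ∷
    (d ∷ c ∷ A ∷ []) ∷ (A ∷ c ∷ B ∷ D ∷ []) ∷ (d ∷ A ∷ c ∷ []) ∷ (a ∷ a ∷ a ∷ D ∷ []) ∷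
    (C ∷ B ∷ a ∷ B ∷ []) ∷ (A ∷ d ∷ C ∷ b ∷ []) ∷ (A ∷ b ∷ C ∷ C ∷ []) ∷ (B ∷ A ∷ b ∷ []) ∷
    (A ∷ d ∷ c ∷ []) ∷ (d ∷ A ∷ D ∷ []) ∷ (a ∷ B ∷ B ∷ C ∷ []) ∷ (B ∷ B ∷ d ∷ a ∷ []) ∷
    (A ∷ D ∷ C ∷ []) ∷ (a ∷ B ∷ B ∷ d ∷ []) ∷ (d ∷ d ∷ A ∷ b ∷ []) ∷ (A ∷ []) ∷ (D ∷ A ∷ C ∷ []) ∷
    (C ∷ A ∷ c ∷ []) ∷ (A ∷ c ∷ d ∷ []) ∷ (D ∷ A ∷ d ∷ []) ∷ (a ∷ b ∷ b ∷ b ∷ []) ∷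
    (A ∷ D ∷ c ∷ B ∷ []) ∷ (A ∷ C ∷ D ∷ []) ∷ (b ∷ d ∷ C ∷ A ∷ []) ∷ (C ∷ A ∷ D ∷ []) ∷
    (c ∷ B ∷ A ∷ D ∷ []) ∷ (d ∷ A ∷ b ∷ d ∷ []) ∷ (B ∷ d ∷ a ∷ B ∷ []) ∷ (c ∷ d ∷ A ∷ []) ∷
    (c ∷ A ∷ C ∷ []) ∷ []
  ) ∷
  []

word : G → Word
word (x , y) = lookup (lookup table x) y

word-spells : ∀ g → eval (word g) ≡ g × length (word g) ≤ 4
word-spells = toWitness {a? = ∀-Fin×? λ g → (eval (word g) ≟ g) ×-dec (length (word g) ≤? 4)} tt

dist≤4 : ∀ x y → DistLE x y 4
dist≤4 x y = length (word g) , proj₂ (word-spells g) , walk-to x y (word g) (proj₁ (word-spells g))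
  where g = inv x · y

y₀ : G
y₀ = mk 4 36

dist[e,y₀]≥4 : ∀ n → Walk e y₀ n → 4 ≤ n
dist[e,y₀]≥4 0 = ⊥-elim ∘ toWitnessFalse {a? = walk? e y₀ 0} tt
dist[e,y₀]≥4 1 = ⊥-elim ∘ toWitnessFalse {a? = walk? e y₀ 1} tt
dist[e,y₀]≥4 2 = ⊥-elim ∘ toWitnessFalse {a? = walk? e y₀ 2} tt
dist[e,y₀]≥4 3 = ⊥-elim ∘ toWitnessFalse {a? = walk? e y₀ 3} tt
dist[e,y₀]≥4 (suc (suc (suc (suc n)))) _ = m≤m+n 4 n

mainTheorem8 : ((∀ g → (g · inv g ≡ e) × (inv g · g ≡ e))
                 × (length S ≡ 8) × Unique S × All (λ s → s ≢ e) S)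
                 × Connected × Regular 8 × Diameter 4 × (G ↔ Fin 1012)
mainTheorem8 = (·-inverse , refl , S-unique , S-nonidentity)
  , (λ x y → let n , _ , walk = dist≤4 x y in n , walk)
  , regular
  , (dist≤4 , e , y₀ , dist[e,y₀]≥4)
  , ↔-sym *↔×
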